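{- For all integers $n\geq 0$ and $k\in\mathbb{Z}$, \[ E_{n}^{(k)}(x)=\sum_{m=0}^{n}\sum_{l=1}^{m+1}\binom{n}{m}\frac{2^{m}(-1)^{m+1+l}\,l!}{l^{k}(m+1)}\,S_{2}(m+1,l)\,E_{n-m}(x). \]
   Context: For $k\in\mathbb{Z}$, $\mathrm{Li}_k(z)=\sum_{n=1}^{\infty}\frac{z^n}{n^k}$. The poly-Euler polynomials $E_n^{(k)}(x)$ are defined by \[ \frac{\mathrm{Li}_{k}(1-e^{ -2t})}{t(e^{t}+1)}e^{xt}=\sum_{n=0}^{\infty}E_{n}^{(k)}(x)\frac{t^{n}}{n!}. \] The (ordinary) Euler polynomials are defined by $\frac{2}{e^t+1}e^{xt}=\sum_{n\ge0}E_n(x)\frac{t^n}{n!}$. The Stirling numbers of the second kind are defined by $\frac{1}{m!}(e^t-1)^m=\sum_{n=m}^{\infty}S_2(n,m)\frac{t^n}{n!}$. -}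

module Defs where

open import Data.Nat as ℕ using (ℕ; zero; suc)
open import Data.Nat.Combinatorics using (_C_)
open import Data.Integer as ℤ using (ℤ; +_; -[1+_])
open import Data.Rational as ℚ using (ℚ; 0ℚ; 1ℚ; ½; _+_; _*_; -_; _/_)
open import Data.List using (List; []; _∷_)

nℚ : ℕ → ℚ
nℚ n = + n / 1

_^ℚ_ : ℚ → ℕ → ℚ
q ^ℚ zero = 1ℚ
q ^ℚ suc n = q * (q ^ℚ n)

factℚ : ℕ → ℚ
factℚ zero = 1ℚ
factℚ (suc n) = nℚ (suc n) * factℚ n

invFact : ℕ → ℚ
invFact zero = 1ℚ
invFact (suc n) = (+ 1 / suc n) * invFact n

-- j^(-k) for j ≥ 1 and k ∈ ℤ, i.e. 1 / (suc j')^k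
invPowℤ : ℕ → ℤ → ℚ
invPowℤ j' (+ m) = (+ 1 / suc j') ^ℚ m
invPowℤ j' -[1+ m ] = nℚ (suc j') ^ℚ suc m

sumTo : ℕ → (ℕ → ℚ) → ℚ
sumTo zero f = f 0
sumTo (suc n) f = sumTo n f + f (suc n)

sum1To : ℕ → (ℕ → ℚ) → ℚ
sum1To zero f = 0ℚ
sum1To (suc n) f = sum1To n f + f (suc n)

-- Formal power series in t over ℚ: coefficient sequences

Series : Set
Series = ℕ → ℚ

_⊛_ : Series → Series → Series
(f ⊛ g) n = sumTo n (λ i → f i * g (n ℕ.∸ i))

pow : Series → ℕ → Series
pow f zero zero = 1ℚ
pow f zero (suc n) = 0ℚ
pow f (suc j) = f ⊛ pow f j

-- exp(a t) = Σ a^n t^n / n!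
expS : ℚ → Series
expS a n = (a ^ℚ n) * invFact n

-- multiplicative inverse of a series f, given c = 1 / f 0.
-- Coefficients c_0 = c,  c_n = - c * Σ_{i=1}^{n} f i * c_{n-i}.
-- 'prevs f c n' is the list [c_{n-1}, ..., c_0].
private
  dot : Series → ℕ → List ℚ → ℚ
  dot f i [] = 0ℚ
  dot f i (r ∷ rs) = f i * r + dot f (suc i) rs

  next : Series → ℚ → List ℚ → ℚ
  next f c [] = c
  next f c rs@(_ ∷ _) = - (c * dot f 1 rs)

  prevs : Series → ℚ → ℕ → List ℚ
  prevs f c zero = []
  prevs f c (suc n) = next f c (prevs f c n) ∷ prevs f c n

invS : Series → ℚ → Series
invS f c n = next f c (prevs f c n)

-- e^t + 1   (constant term 2, inverse of constant term ½)
expPlusOne : Series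
expPlusOne zero = nℚ 2
expPlusOne (suc n) = invFact (suc n)

invExpPlusOne : Series
invExpPlusOne = invS expPlusOne ½

oneMinusExpNeg2 : Series
oneMinusExpNeg2 zero = 0ℚ
oneMinusExpNeg2 (suc n) = - expS (- nℚ 2) (suc n)

-- Li_k(g(t)) = Σ_{j ≥ 1} g(t)^j / j^k ; since g has zero constant term,
-- the coefficient of t^N only involves j ≤ N.
LiComp : ℤ → Series
LiComp k N = sum1To N (λ j → invPowℤ (j ℕ.∸ 1) k * pow oneMinusExpNeg2 j N)

-- Li_k(1 - e^{-2t}) / t
LiOverT : ℤ → Series
LiOverT k n = LiComp k (suc n)

-- poly-Euler polynomial E_n^{(k)}(x), evaluated at x ∈ ℚ:
-- n! · [t^n] Li_k(1-e^{-2t}) / (t (e^t+1)) · e^{xt}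
polyEuler : ℕ → ℤ → ℚ → ℚ
polyEuler n k x = factℚ n * ((LiOverT k ⊛ invExpPlusOne) ⊛ expS x) n

-- Euler polynomial E_n(x): n! · [t^n] 2/(e^t+1) · e^{xt}
euler : ℕ → ℚ → ℚ
euler n x = factℚ n * ((λ i → nℚ 2 * invExpPlusOne i) ⊛ expS x) n

-- Stirling numbers of the second kind: n! · [t^n] (e^t - 1)^m / m!
expMinusOne : Series
expMinusOne zero = 0ℚ
expMinusOne (suc n) = invFact (suc n)

S2 : ℕ → ℕ → ℚ
S2 n m = factℚ n * (invFact m * pow expMinusOne m n)

{-# OPTIONS --safe #-}
-- Since 1 - e^{-2t} = -(e^{-2t} - 1), the j-th power of it has t^N-coefficient
-- (-1)^{N+j} 2^N j! S₂(N,j) / N!, so the coefficient of t^m in Li_k(1-e^{-2t})/t is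
-- Σ_l (-1)^{m+1+l} 2^{m+1} l! S₂(m+1,l) / (l^k (m+1)!).  Multiplying by
-- e^{xt}/(e^t+1) = ½ Σ_j E_j(x) t^j / j! (associativity of the Cauchy product) and
-- comparing coefficients of t^n gives the formula, the binomial coefficient arising
-- from n! / (m! (n-m)!).
module Submission where

open import Defs
open import Data.Nat as ℕ using (ℕ; zero; suc; _∸_; _≤_)
import Data.Nat.Properties as ℕ
open import Data.Nat.Combinatorics using (_C_; nCk≡n!/k![n-k]!; k![n∸k]!∣n!)
open import Data.Nat.DivMod using (m/n*n≡m)
open import Data.Integer using (ℤ; +_)
open import Data.Integer.Properties using (pos-*)
open import Data.Rational using (ℚ; _+_; _*_; -_; _/_; 1ℚ; fromℚᵘ)
open import Data.Rational.Properties
  using (toℚᵘ-injective; toℚᵘ-fromℚᵘ; toℚᵘ-homo-*; fromℚᵘ-cong;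
         +-assoc; *-assoc; *-identityˡ; *-identityʳ; *-zeroˡ; *-zeroʳ;
         *-distribˡ-+; *-distribʳ-+)
open import Data.Rational.Unnormalised as ℚᵘ using (mkℚᵘ)
import Data.Rational.Unnormalised.Properties as ℚᵘ
open import Data.Rational.Solver using (module +-*-Solver)
open +-*-Solver
open import Relation.Binary.PropositionalEquality
open ≡-Reasoning

fromℚᵘ-homo-* : ∀ p q → fromℚᵘ (p ℚᵘ.* q) ≡ fromℚᵘ p * fromℚᵘ q
fromℚᵘ-homo-* p q = toℚᵘ-injective
  (ℚᵘ.≃-trans (toℚᵘ-fromℚᵘ (p ℚᵘ.* q)) (ℚᵘ.≃-sym
    (ℚᵘ.≃-trans (toℚᵘ-homo-* (fromℚᵘ p) (fromℚᵘ q))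
                (ℚᵘ.*-cong (toℚᵘ-fromℚᵘ p) (toℚᵘ-fromℚᵘ q)))))

nℚ-* : ∀ a b → nℚ (a ℕ.* b) ≡ nℚ a * nℚ b
nℚ-* a b = trans (cong (λ z → fromℚᵘ (mkℚᵘ z 0)) (pos-* a b))
                 (fromℚᵘ-homo-* (mkℚᵘ (+ a) 0) (mkℚᵘ (+ b) 0))

1/suc*nℚ-suc≡1 : ∀ m → (+ 1 / suc m) * nℚ (suc m) ≡ 1ℚ
1/suc*nℚ-suc≡1 m = trans (sym (fromℚᵘ-homo-* (mkℚᵘ (+ 1) m) (mkℚᵘ (+ suc m) 0)))
                         (fromℚᵘ-cong (ℚᵘ.*-inverseˡ (mkℚᵘ (+ suc m) 0)))

1/suc*factℚ-suc : ∀ m → (+ 1 / suc m) * factℚ (suc m) ≡ factℚ m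
1/suc*factℚ-suc m = begin
  (+ 1 / suc m) * (nℚ (suc m) * factℚ m) ≡⟨ *-assoc (+ 1 / suc m) _ _ ⟨
  (+ 1 / suc m) * nℚ (suc m) * factℚ m   ≡⟨ cong (_* factℚ m) (1/suc*nℚ-suc≡1 m) ⟩
  1ℚ * factℚ m                           ≡⟨ *-identityˡ (factℚ m) ⟩
  factℚ m                                ∎

factℚ*invFact≡1 : ∀ l → factℚ l * invFact l ≡ 1ℚ
factℚ*invFact≡1 zero = refl
factℚ*invFact≡1 (suc l) = begin
  nℚ (suc l) * factℚ l * ((+ 1 / suc l) * invFact l)
    ≡⟨ solve 4 (λ N f i j → N :* f :* (i :* j) := (i :* N) :* (f :* j)) refl
               (nℚ (suc l)) (factℚ l) (+ 1 / suc l) (invFact l) ⟩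
  ((+ 1 / suc l) * nℚ (suc l)) * (factℚ l * invFact l)
    ≡⟨ cong₂ _*_ (1/suc*nℚ-suc≡1 l) (factℚ*invFact≡1 l) ⟩
  1ℚ ∎

factℚ≡nℚ-! : ∀ n → factℚ n ≡ nℚ (n ℕ.!)
factℚ≡nℚ-! zero = refl
factℚ≡nℚ-! (suc n) = trans (cong (nℚ (suc n) *_) (factℚ≡nℚ-! n)) (sym (nℚ-* (suc n) (n ℕ.!)))

factℚ≡C*factℚ*factℚ : ∀ {n m} → m ≤ n → factℚ n ≡ nℚ (n C m) * factℚ m * factℚ (n ∸ m)
factℚ≡C*factℚ*factℚ {n} {m} m≤n = begin
  factℚ n                                          ≡⟨ factℚ≡nℚ-! n ⟩
  nℚ (n ℕ.!)                                       ≡⟨ cong nℚ n!≡C*m!*[n∸m]! ⟨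
  nℚ ((n C m) ℕ.* (m ℕ.! ℕ.* (n ∸ m) ℕ.!))         ≡⟨ nℚ-* (n C m) _ ⟩
  nℚ (n C m) * nℚ (m ℕ.! ℕ.* (n ∸ m) ℕ.!)          ≡⟨ cong (nℚ (n C m) *_) (nℚ-* (m ℕ.!) ((n ∸ m) ℕ.!)) ⟩
  nℚ (n C m) * (nℚ (m ℕ.!) * nℚ ((n ∸ m) ℕ.!))     ≡⟨ *-assoc (nℚ (n C m)) _ _ ⟨
  nℚ (n C m) * nℚ (m ℕ.!) * nℚ ((n ∸ m) ℕ.!)       ≡⟨ cong₂ (λ a b → nℚ (n C m) * a * b) (factℚ≡nℚ-! m) (factℚ≡nℚ-! (n ∸ m)) ⟨
  nℚ (n C m) * factℚ m * factℚ (n ∸ m)             ∎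
  where
  n!≡C*m!*[n∸m]! : (n C m) ℕ.* (m ℕ.! ℕ.* (n ∸ m) ℕ.!) ≡ n ℕ.!
  n!≡C*m!*[n∸m]! = trans (cong (ℕ._* (m ℕ.! ℕ.* (n ∸ m) ℕ.!)) (nCk≡n!/k![n-k]! m≤n))
                         (m/n*n≡m {{m ℕ.!* (n ∸ m) !≢0}} (k![n∸k]!∣n! m≤n))

^ℚ-+ : ∀ q a b → q ^ℚ (a ℕ.+ b) ≡ (q ^ℚ a) * (q ^ℚ b)
^ℚ-+ q zero b = sym (*-identityˡ (q ^ℚ b))
^ℚ-+ q (suc a) b = trans (cong (q *_) (^ℚ-+ q a b)) (sym (*-assoc q (q ^ℚ a) (q ^ℚ b)))

^ℚ-distrib-* : ∀ p q n → (p * q) ^ℚ n ≡ (p ^ℚ n) * (q ^ℚ n)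
^ℚ-distrib-* p q zero = refl
^ℚ-distrib-* p q (suc n) = trans (cong ((p * q) *_) (^ℚ-distrib-* p q n))
  (solve 4 (λ a b c d → (a :* b) :* (c :* d) := (a :* c) :* (b :* d)) refl p q (p ^ℚ n) (q ^ℚ n))

^ℚ-split : ∀ r {i n} → i ≤ n → (r ^ℚ i) * (r ^ℚ (n ∸ i)) ≡ r ^ℚ n
^ℚ-split r {i} {n} i≤n = trans (sym (^ℚ-+ r i (n ∸ i))) (cong (r ^ℚ_) (ℕ.m+[n∸m]≡n i≤n))

sumTo-cong : ∀ n {f g : ℕ → ℚ} → (∀ i → i ≤ n → f i ≡ g i) → sumTo n f ≡ sumTo n g
sumTo-cong zero f≗g = f≗g 0 ℕ.z≤n
sumTo-cong (suc n) f≗g =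
  cong₂ _+_ (sumTo-cong n (λ i i≤n → f≗g i (ℕ.m≤n⇒m≤1+n i≤n))) (f≗g (suc n) ℕ.≤-refl)

sumTo-*ˡ : ∀ n c (f : ℕ → ℚ) → c * sumTo n f ≡ sumTo n (λ i → c * f i)
sumTo-*ˡ zero c f = refl
sumTo-*ˡ (suc n) c f =
  trans (*-distribˡ-+ c (sumTo n f) (f (suc n))) (cong (_+ c * f (suc n)) (sumTo-*ˡ n c f))

sumTo-*ʳ : ∀ n c (f : ℕ → ℚ) → sumTo n f * c ≡ sumTo n (λ i → f i * c)
sumTo-*ʳ zero c f = refl
sumTo-*ʳ (suc n) c f =
  trans (*-distribʳ-+ c (sumTo n f) (f (suc n))) (cong (_+ f (suc n) * c) (sumTo-*ʳ n c f))

sumTo-+ : ∀ n (f g : ℕ → ℚ) → sumTo n (λ i → f i + g i) ≡ sumTo n f + sumTo n g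
sumTo-+ zero f g = refl
sumTo-+ (suc n) f g = trans (cong (_+ (f (suc n) + g (suc n))) (sumTo-+ n f g))
  (solve 4 (λ a b c d → (a :+ b) :+ (c :+ d) := (a :+ c) :+ (b :+ d)) refl
         (sumTo n f) (sumTo n g) (f (suc n)) (g (suc n)))

sumTo-triangle : ∀ n (F : ℕ → ℕ → ℚ) →
  sumTo n (λ i → sumTo i (λ m → F m (i ∸ m))) ≡ sumTo n (λ m → sumTo (n ∸ m) (F m))
sumTo-triangle zero F = refl
sumTo-triangle (suc n) F = begin
  S + (D + B)          ≡⟨ cong (_+ (D + B)) (sumTo-triangle n F) ⟩
  T + (D + B)          ≡⟨ +-assoc T D B ⟨
  (T + D) + B          ≡⟨ cong (_+ B) (sumTo-+ n _ _) ⟨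
  sumTo n (λ m → sumTo (n ∸ m) (F m) + F m (suc n ∸ m)) + B
    ≡⟨ cong₂ _+_ (sym (sumTo-cong n extend)) lastTerm ⟩
  sumTo n (λ m → sumTo (suc n ∸ m) (F m)) + sumTo (suc n ∸ suc n) (F (suc n)) ∎
  where
  S = sumTo n (λ i → sumTo i (λ m → F m (i ∸ m)))
  T = sumTo n (λ m → sumTo (n ∸ m) (F m))
  D = sumTo n (λ m → F m (suc n ∸ m))
  B = F (suc n) (n ∸ n)
  lastTerm : B ≡ sumTo (n ∸ n) (F (suc n))
  lastTerm rewrite ℕ.n∸n≡0 n = refl
  extend : ∀ m → m ≤ n → sumTo (suc n ∸ m) (F m) ≡ sumTo (n ∸ m) (F m) + F m (suc n ∸ m)
  extend m m≤n rewrite ℕ.+-∸-assoc 1 m≤n = refl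

sum1To-cong : ∀ n {f g : ℕ → ℚ} → (∀ i → f i ≡ g i) → sum1To n f ≡ sum1To n g
sum1To-cong zero f≗g = refl
sum1To-cong (suc n) f≗g = cong₂ _+_ (sum1To-cong n f≗g) (f≗g (suc n))

sum1To-*ˡ : ∀ n c (f : ℕ → ℚ) → c * sum1To n f ≡ sum1To n (λ i → c * f i)
sum1To-*ˡ zero c f = *-zeroʳ c
sum1To-*ˡ (suc n) c f =
  trans (*-distribˡ-+ c (sum1To n f) (f (suc n))) (cong (_+ c * f (suc n)) (sum1To-*ˡ n c f))

sum1To-*ʳ : ∀ n c (f : ℕ → ℚ) → sum1To n f * c ≡ sum1To n (λ i → f i * c)
sum1To-*ʳ zero c f = *-zeroˡ c
sum1To-*ʳ (suc n) c f =
  trans (*-distribʳ-+ c (sum1To n f) (f (suc n))) (cong (_+ f (suc n) * c) (sum1To-*ʳ n c f))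

⊛-assoc : ∀ f g h n → ((f ⊛ g) ⊛ h) n ≡ (f ⊛ (g ⊛ h)) n
⊛-assoc f g h n = begin
  sumTo n (λ i → sumTo i (λ m → f m * g (i ∸ m)) * h (n ∸ i))
    ≡⟨ sumTo-cong n distribute ⟩
  sumTo n (λ i → sumTo i (λ m → F m (i ∸ m)))
    ≡⟨ sumTo-triangle n F ⟩
  sumTo n (λ m → sumTo (n ∸ m) (F m))
    ≡⟨ sumTo-cong n factor ⟩
  sumTo n (λ m → f m * (g ⊛ h) (n ∸ m)) ∎
  where
  F : ℕ → ℕ → ℚ
  F m j = f m * g j * h (n ∸ (m ℕ.+ j))
  distribute : ∀ i → i ≤ n → sumTo i (λ m → f m * g (i ∸ m)) * h (n ∸ i) ≡ sumTo i (λ m → F m (i ∸ m))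
  distribute i _ = trans (sumTo-*ʳ i (h (n ∸ i)) _)
    (sumTo-cong i (λ m m≤i → cong (λ z → f m * g (i ∸ m) * h (n ∸ z)) (sym (ℕ.m+[n∸m]≡n m≤i))))
  factor : ∀ m → m ≤ n → sumTo (n ∸ m) (F m) ≡ f m * (g ⊛ h) (n ∸ m)
  factor m _ = trans (sumTo-cong (n ∸ m) (λ j _ →
      trans (*-assoc (f m) (g j) _) (cong (λ z → f m * (g j * h z)) (sym (ℕ.∸-+-assoc n m j)))))
    (sym (sumTo-*ˡ (n ∸ m) (f m) _))

⊛-*ˡ : ∀ c f g n → ((λ i → c * f i) ⊛ g) n ≡ c * (f ⊛ g) n
⊛-*ˡ c f g n = trans (sumTo-cong n (λ i _ → *-assoc c (f i) _)) (sym (sumTo-*ˡ n c _))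

pow-scale : ∀ {f h : Series} c r → (∀ i → f i ≡ c * (r ^ℚ i) * h i) →
            ∀ j n → pow f j n ≡ (c ^ℚ j) * (r ^ℚ n) * pow h j n
pow-scale c r f≡ zero zero = refl
pow-scale c r f≡ zero (suc n) = sym (*-zeroʳ (1ℚ * (r * (r ^ℚ n))))
pow-scale {f} {h} c r f≡ (suc j) n = begin
  sumTo n (λ i → f i * pow f j (n ∸ i))
    ≡⟨ sumTo-cong n term ⟩
  sumTo n (λ i → (c ^ℚ suc j) * (r ^ℚ n) * (h i * pow h j (n ∸ i)))
    ≡⟨ sumTo-*ˡ n ((c ^ℚ suc j) * (r ^ℚ n)) _ ⟨
  (c ^ℚ suc j) * (r ^ℚ n) * sumTo n (λ i → h i * pow h j (n ∸ i)) ∎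
  where
  term : ∀ i → i ≤ n → f i * pow f j (n ∸ i) ≡ (c ^ℚ suc j) * (r ^ℚ n) * (h i * pow h j (n ∸ i))
  term i i≤n = begin
    f i * pow f j (n ∸ i)
      ≡⟨ cong₂ _*_ (f≡ i) (pow-scale c r f≡ j (n ∸ i)) ⟩
    (c * (r ^ℚ i) * h i) * ((c ^ℚ j) * (r ^ℚ (n ∸ i)) * pow h j (n ∸ i))
      ≡⟨ solve 6 (λ c ri hi cj rni P → (c :* ri :* hi) :* (cj :* rni :* P)
                                     := (c :* cj) :* (ri :* rni) :* (hi :* P))
               refl c (r ^ℚ i) (h i) (c ^ℚ j) (r ^ℚ (n ∸ i)) (pow h j (n ∸ i)) ⟩
    (c ^ℚ suc j) * ((r ^ℚ i) * (r ^ℚ (n ∸ i))) * (h i * pow h j (n ∸ i))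
      ≡⟨ cong (λ z → (c ^ℚ suc j) * z * (h i * pow h j (n ∸ i))) (^ℚ-split r i≤n) ⟩
    (c ^ℚ suc j) * (r ^ℚ n) * (h i * pow h j (n ∸ i)) ∎

oneMinusExpNeg2≡scaled : ∀ i → oneMinusExpNeg2 i ≡ (- 1ℚ) * ((- nℚ 2) ^ℚ i) * expMinusOne i
oneMinusExpNeg2≡scaled zero = refl
oneMinusExpNeg2≡scaled (suc n) = solve 2 (λ a b → :- (a :* b) := (:- con 1ℚ) :* a :* b) refl
  ((- nℚ 2) ^ℚ suc n) (invFact (suc n))

pow-oneMinusExpNeg2 : ∀ l N →
  pow oneMinusExpNeg2 l N ≡ ((- 1ℚ) ^ℚ (N ℕ.+ l)) * (nℚ 2 ^ℚ N) * pow expMinusOne l N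
pow-oneMinusExpNeg2 l N = begin
  pow oneMinusExpNeg2 l N
    ≡⟨ pow-scale (- 1ℚ) (- nℚ 2) oneMinusExpNeg2≡scaled l N ⟩
  s ^ℚ l * (s * nℚ 2) ^ℚ N * H
    ≡⟨ cong (λ z → s ^ℚ l * z * H) (^ℚ-distrib-* s (nℚ 2) N) ⟩
  s ^ℚ l * (s ^ℚ N * nℚ 2 ^ℚ N) * H
    ≡⟨ solve 4 (λ a b c d → a :* (b :* c) :* d := b :* a :* c :* d) refl (s ^ℚ l) (s ^ℚ N) (nℚ 2 ^ℚ N) H ⟩
  s ^ℚ N * s ^ℚ l * nℚ 2 ^ℚ N * H
    ≡⟨ cong (λ z → z * nℚ 2 ^ℚ N * H) (^ℚ-+ s N l) ⟨
  s ^ℚ (N ℕ.+ l) * nℚ 2 ^ℚ N * H ∎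
  where
  s = - 1ℚ
  H = pow expMinusOne l N

module _ (k : ℤ) (m : ℕ) where

  LiCoeffTerm : ℕ → ℚ
  LiCoeffTerm l = (nℚ 2 ^ℚ m) * ((- 1ℚ) ^ℚ (suc m ℕ.+ l)) * factℚ l
                * invPowℤ (l ∸ 1) k * (+ 1 / suc m) * S2 (suc m) l

  factℚ*LiComp-term : ∀ l →
    factℚ m * (invPowℤ (l ∸ 1) k * pow oneMinusExpNeg2 l (suc m)) ≡ nℚ 2 * LiCoeffTerm l
  factℚ*LiComp-term l = begin
    m! * (ip * pow oneMinusExpNeg2 l (suc m))
      ≡⟨ cong (λ z → m! * (ip * z)) (pow-oneMinusExpNeg2 l (suc m)) ⟩
    m! * (ip * (s * (nℚ 2 * p) * H))
      ≡⟨ *-identityʳ _ ⟨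
    m! * (ip * (s * (nℚ 2 * p) * H)) * 1ℚ
      ≡⟨ cong₂ (λ a b → a * (ip * (s * (nℚ 2 * p) * H)) * b)
               (1/suc*factℚ-suc m) (factℚ*invFact≡1 l) ⟨
    (iv * [m+1]!) * (ip * (s * (nℚ 2 * p) * H)) * (l! * il)
      ≡⟨ solve 9 (λ iv M ip s two p H L I → (iv :* M) :* (ip :* (s :* (two :* p) :* H)) :* (L :* I)
                                        := two :* (p :* s :* L :* ip :* iv :* (M :* (I :* H))))
               refl iv [m+1]! ip s (nℚ 2) p H l! il ⟩
    nℚ 2 * LiCoeffTerm l ∎
    where
    m! = factℚ m
    [m+1]! = factℚ (suc m)
    l! = factℚ l
    il = invFact l
    iv = + 1 / suc m
    ip = invPowℤ (l ∸ 1) k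
    s = (- 1ℚ) ^ℚ (suc m ℕ.+ l)
    p = nℚ 2 ^ℚ m
    H = pow expMinusOne l (suc m)

  factℚ*LiOverT : factℚ m * LiOverT k m ≡ nℚ 2 * sum1To (suc m) LiCoeffTerm
  factℚ*LiOverT = begin
    factℚ m * LiOverT k m
      ≡⟨ sum1To-*ˡ (suc m) (factℚ m) _ ⟩
    sum1To (suc m) (λ l → factℚ m * (invPowℤ (l ∸ 1) k * pow oneMinusExpNeg2 l (suc m)))
      ≡⟨ sum1To-cong (suc m) factℚ*LiComp-term ⟩
    sum1To (suc m) (λ l → nℚ 2 * LiCoeffTerm l)
      ≡⟨ sum1To-*ˡ (suc m) (nℚ 2) LiCoeffTerm ⟨
    nℚ 2 * sum1To (suc m) LiCoeffTerm ∎

euler≡factℚ*2*coeff : ∀ j x → euler j x ≡ factℚ j * (nℚ 2 * (invExpPlusOne ⊛ expS x) j)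
euler≡factℚ*2*coeff j x = cong (factℚ j *_) (⊛-*ˡ (nℚ 2) invExpPlusOne (expS x) j)

polyEuler-summand : ∀ n k x {m} → m ≤ n →
  factℚ n * (LiOverT k m * (invExpPlusOne ⊛ expS x) (n ∸ m)) ≡
    sum1To (suc m) (λ l → nℚ (n C m) * (nℚ 2 ^ℚ m) * ((- 1ℚ) ^ℚ (suc m ℕ.+ l))
      * factℚ l * invPowℤ (l ∸ 1) k * (+ 1 / suc m) * S2 (suc m) l * euler (n ∸ m) x)
polyEuler-summand n k x {m} m≤n = begin
  factℚ n * (LiOverT k m * q)
    ≡⟨ cong (_* (LiOverT k m * q)) (factℚ≡C*factℚ*factℚ m≤n) ⟩
  Cnm * factℚ m * factℚ (n ∸ m) * (LiOverT k m * q)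
    ≡⟨ solve 5 (λ c a b L Q → c :* a :* b :* (L :* Q) := c :* (a :* L) :* (b :* Q)) refl
             Cnm (factℚ m) (factℚ (n ∸ m)) (LiOverT k m) q ⟩
  Cnm * (factℚ m * LiOverT k m) * (factℚ (n ∸ m) * q)
    ≡⟨ cong (λ z → Cnm * z * (factℚ (n ∸ m) * q)) (factℚ*LiOverT k m) ⟩
  Cnm * (nℚ 2 * ΣL) * (factℚ (n ∸ m) * q)
    ≡⟨ solve 5 (λ c two s f Q → c :* (two :* s) :* (f :* Q) := c :* s :* (f :* (two :* Q))) refl
             Cnm (nℚ 2) ΣL (factℚ (n ∸ m)) q ⟩
  Cnm * ΣL * (factℚ (n ∸ m) * (nℚ 2 * q))
    ≡⟨ cong (Cnm * ΣL *_) (euler≡factℚ*2*coeff (n ∸ m) x) ⟨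
  Cnm * ΣL * euler (n ∸ m) x
    ≡⟨ cong (_* euler (n ∸ m) x) (sum1To-*ˡ (suc m) Cnm (LiCoeffTerm k m)) ⟩
  sum1To (suc m) (λ l → Cnm * LiCoeffTerm k m l) * euler (n ∸ m) x
    ≡⟨ sum1To-*ʳ (suc m) (euler (n ∸ m) x) _ ⟩
  sum1To (suc m) (λ l → Cnm * LiCoeffTerm k m l * euler (n ∸ m) x)
    ≡⟨ sum1To-cong (suc m) (λ l → cong (_* euler (n ∸ m) x) (reassociate l)) ⟩
  _ ∎
  where
  Cnm = nℚ (n C m)
  ΣL = sum1To (suc m) (LiCoeffTerm k m)
  q = (invExpPlusOne ⊛ expS x) (n ∸ m)
  reassociate : ∀ l → Cnm * LiCoeffTerm k m l ≡ Cnm * (nℚ 2 ^ℚ m) * ((- 1ℚ) ^ℚ (suc m ℕ.+ l))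
                * factℚ l * invPowℤ (l ∸ 1) k * (+ 1 / suc m) * S2 (suc m) l
  reassociate l = solve 7 (λ c a b d e f g → c :* (a :* b :* d :* e :* f :* g)
                                          := c :* a :* b :* d :* e :* f :* g) refl
    Cnm (nℚ 2 ^ℚ m) ((- 1ℚ) ^ℚ (suc m ℕ.+ l)) (factℚ l) (invPowℤ (l ∸ 1) k) (+ 1 / suc m) (S2 (suc m) l)

mainTheorem4 : (n : ℕ) (k : ℤ) (x : ℚ) →
    polyEuler n k x ≡
      sumTo n (λ m → sum1To (suc m) (λ l →
        nℚ (n C m) * (nℚ 2 ^ℚ m) * ((- 1ℚ) ^ℚ (suc m ℕ.+ l))
          * factℚ l * invPowℤ (l ∸ 1) k * (+ 1 / suc m)
          * S2 (suc m) l * euler (n ∸ m) x))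
mainTheorem4 n k x = begin
  factℚ n * ((LiOverT k ⊛ invExpPlusOne) ⊛ expS x) n
    ≡⟨ cong (factℚ n *_) (⊛-assoc (LiOverT k) invExpPlusOne (expS x) n) ⟩
  factℚ n * sumTo n (λ m → LiOverT k m * (invExpPlusOne ⊛ expS x) (n ∸ m))
    ≡⟨ sumTo-*ˡ n (factℚ n) _ ⟩
  sumTo n (λ m → factℚ n * (LiOverT k m * (invExpPlusOne ⊛ expS x) (n ∸ m)))
    ≡⟨ sumTo-cong n (λ m → polyEuler-summand n k x) ⟩
  _ ∎
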